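{- Let $G$ be a planar graph of order $n\ge 6$ containing no cycle of length 4, and suppose the vertex connectivity of its complement satisfies $k(G^c)\le 2$. Then there exist two vertices $x,y$ which separate some vertex $z$ from the rest of $G^c$ (i.e. in $G^c-\{x,y\}$ the vertex $z$ has no neighbours), and furthermore $G-\{x,y,z\}$ contains no path of length 2.
   Context: All graphs are simple; $G^c$ denotes the complement of $G$ and $k(\cdot)$ denotes vertex connectivity. A path of length 2 means a path with 2 edges. -}

module Defs where

open import Data.Nat using (ℕ; zero; suc; _+_; _≤_)
open import Data.Fin using (Fin)
open import Data.Fin.Subset using (Subset; _∈_; _∉_; ∣_∣)
open import Data.Product using (Σ; ∃; _×_; _,_; proj₁; proj₂)
open import Data.Sum using (_⊎_)
open import Data.Unit using (⊤)
open import Data.Empty using (⊥)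
open import Relation.Nullary using (¬_)
open import Relation.Binary.PropositionalEquality using (_≡_; _≢_)
open import Relation.Binary using (Decidable)

record Graph (n : ℕ) : Set₁ where
  field
    Adj    : Fin n → Fin n → Set
    adj?   : Decidable Adj
    sym    : ∀ {u v} → Adj u v → Adj v u
    irrefl : ∀ {u} → ¬ Adj u u
open Graph public

complement : ∀ {n} → Graph n → Graph n
complement {n} G = record
  { Adj    = λ u v → u ≢ v × ¬ Adj G u v
  ; adj?   = dec
  ; sym    = λ { (u≢v , ¬a) → (λ e → u≢v (Relation.Binary.PropositionalEquality.sym e))
                            , (λ a → ¬a (Graph.sym G a)) }
  ; irrefl = λ { (u≢u , _) → u≢u Relation.Binary.PropositionalEquality.refl }
  }
  where
  open import Relation.Nullary using (Dec; yes; no)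
  open import Data.Fin using (_≟_)
  dec : Decidable (λ u v → u ≢ v × ¬ Adj G u v)
  dec u v with u ≟ v | adj? G u v
  ... | yes e | _     = no (λ p → proj₁ p e)
  ... | no ne | yes a = no (λ p → proj₂ p a)
  ... | no ne | no na = yes (ne , na)

-- Reachability in G - S (S given as a predicate on vertices):
-- a walk from u to w all of whose vertices after the first avoid S.
data Reach {n : ℕ} (G : Graph n) (S : Fin n → Set) : Fin n → Fin n → Set where
  here : ∀ {u} → Reach G S u u
  step : ∀ {u v w} → Adj G u v → ¬ S v → Reach G S v w → Reach G S u w

-- S is a separating set in the sense of vertex connectivity:
-- G - S is disconnected, or G - S has at most one vertex.
Separates : ∀ {n} → Graph n → Subset n → Set
Separates {n} G S =
  (∃ λ u → ∃ λ v → u ∉ S × v ∉ S × ¬ Reach G (λ w → w ∈ S) u v)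
  ⊎ (n ≤ ∣ S ∣ + 1)

IsConnectivity : ∀ {n} → Graph n → ℕ → Set
IsConnectivity {n} G k =
  (∃ λ (S : Subset n) → ∣ S ∣ ≡ k × Separates G S)
  × (∀ (S : Subset n) → Separates G S → k ≤ ∣ S ∣)

-- G contains no cycle of length 4 (as a subgraph).
-- (a ≠ b, b ≠ c, c ≠ d, d ≠ a follow from irreflexivity.)
NoC4 : ∀ {n} → Graph n → Set
NoC4 {n} G = ∀ (a b c d : Fin n) → a ≢ c → b ≢ d →
  Adj G a b → Adj G b c → Adj G c d → Adj G d a → ⊥

iter : ∀ {A : Set} → (A → A) → ℕ → A → A
iter f zero    x = x
iter f (suc k) x = f (iter f k x)

HasClasses : {A : Set} → (P : A → Set) → (R : A → A → Set) → ℕ → Set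
HasClasses {A} P R k =
  Σ (Fin k → A) λ r →
    (∀ i → P (r i))
    × (∀ i j → R (r i) (r j) → i ≡ j)
    × (∀ a → P a → Σ (Fin k) λ i → R (r i) a)

Dart : ∀ {n} → Graph n → Fin n × Fin n → Set
Dart G (u , v) = Adj G u v

record Rotation {n : ℕ} (G : Graph n) : Set where
  field
    σ     : Fin n → Fin n → Fin n
    σ-nbr : ∀ {v u} → Adj G v u → Adj G v (σ v u)
    σ-inj : ∀ {v u w} → Adj G v u → Adj G v w → σ v u ≡ σ v w → u ≡ w
    σ-cyc : ∀ {v u w} → Adj G v u → Adj G v w → ∃ λ k → iter (σ v) k u ≡ w
  -- face-tracing permutation on darts
  φ : Fin n × Fin n → Fin n × Fin n
  φ (u , v) = v , σ v u
  SameFace : Fin n × Fin n → Fin n × Fin n → Set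
  SameFace d d' = ∃ λ k → iter φ k d ≡ d'
open Rotation public

SameEdge : ∀ {n} → Fin n × Fin n → Fin n × Fin n → Set
SameEdge (u , v) (u' , v') = ((u ≡ u') × (v ≡ v')) ⊎ ((u ≡ v') × (v ≡ u'))

Isolated : ∀ {n} → Graph n → Fin n → Set
Isolated G v = ∀ u → ¬ Adj G v u

-- G is planar: it has m edges, c components, i isolated vertices, and a
-- rotation system with f faces (dart orbits) satisfying Euler's formula
-- for genus 0 on every component:  n - m + f = 2c - i.
Planar : ∀ {n} → Graph n → Set
Planar {n} G =
  ∃ λ m → ∃ λ c → ∃ λ i →
    HasClasses (Dart G) SameEdge m
    × HasClasses (λ _ → ⊤) (Reach G (λ _ → ⊥)) c
    × HasClasses (Isolated G) _≡_ i
    × Σ (Rotation G) λ ρ → ∃ λ f →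
        HasClasses (Dart G) (SameFace ρ) f
        × n + f + i ≡ m + (c + c)

module Submission where

-- Take a separating set S of Gᶜ with |S| ≤ 2. Every pair of vertices lying in
-- different components of Gᶜ − S is an edge of G. If two such components both
-- contained an edge of Gᶜ, say uw₀ and vw₁, then u v w₀ w₁ would be a 4-cycle
-- of G; hence some vertex z is isolated in Gᶜ − S. Cover S by two vertices x, y
-- other than z: then z is adjacent in G to every vertex outside {x, y, z}, so a
-- path a b c in G − {x, y, z} would close the 4-cycle z a b c.

open import Defs
open import Data.Nat using (ℕ; suc; _≤_; _<_; _+_; z≤n; s≤s)
open import Data.Nat.Properties using (≤-trans; <⇒≱; m≤m+n; +-monoˡ-≤)
open import Data.Fin using (Fin; zero; suc)
open import Data.Fin.Properties using (_≟_; any?; suc-injective)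
open import Data.Fin.Subset using (Subset; _∈_; _∉_; ∣_∣; _-_)
open import Data.Fin.Subset.Properties using (_∈?_; x∈p∧x≢y⇒x∈p-y; x∈p⇒∣p-x∣<∣p∣)
open import Data.Product using (∃; ∃₂; _×_; _,_; proj₁)
open import Data.Sum using (_⊎_; inj₁; inj₂; [_,_]′)
open import Data.Empty using (⊥; ⊥-elim)
open import Function using (_∘_; id)
open import Relation.Nullary using (¬_; yes; no)
open import Relation.Nullary.Decidable using (decidable-stable; ¬?; _×-dec_)
open import Relation.Unary using (Decidable)
open import Relation.Binary.PropositionalEquality using (_≡_; _≢_; refl; ≢-sym)

private
  variable
    n : ℕ

∃suc≢ : ∀ {m} (q : Fin (suc (suc (suc m)))) → ∃ λ y → suc y ≢ q
∃suc≢ zero = zero , λ ()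
∃suc≢ (suc q) with zero ≟ q
... | no 0≢q   = zero , 0≢q ∘ suc-injective
... | yes refl = suc zero , λ ()

avoid₂ : 3 ≤ n → (p q : Fin n) → ∃ λ y → y ≢ p × y ≢ q
avoid₂ (s≤s (s≤s (s≤s _))) p q with zero ≟ p | zero ≟ q
... | no 0≢p   | no 0≢q   = zero , 0≢p , 0≢q
... | yes refl | _        = let y , sy≢q = ∃suc≢ q in suc y , (λ ()) , sy≢q
... | no _     | yes refl = let y , sy≢p = ∃suc≢ p in suc y , sy≢p , (λ ())

three-members⇒3≤∣p∣ : {p : Subset n} {x y s : Fin n} → x ∈ p → y ∈ p → s ∈ p →
                      y ≢ x → s ≢ x → s ≢ y → 3 ≤ ∣ p ∣
three-members⇒3≤∣p∣ {p = p} {x} {y} {s} x∈p y∈p s∈p y≢x s≢x s≢y =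
  ≤-trans (s≤s (≤-trans (s≤s (≤-trans (s≤s z≤n) (x∈p⇒∣p-x∣<∣p∣ s∈p-x-y)))
                        (x∈p⇒∣p-x∣<∣p∣ y∈p-x)))
          (x∈p⇒∣p-x∣<∣p∣ x∈p)
  where
  y∈p-x : y ∈ p - x
  y∈p-x = x∈p∧x≢y⇒x∈p-y y∈p y≢x
  s∈p-x-y : s ∈ p - x - y
  s∈p-x-y = x∈p∧x≢y⇒x∈p-y (x∈p∧x≢y⇒x∈p-y s∈p s≢x) s≢y

CoveringPair : Fin n → Subset n → Set
CoveringPair z S = ∃₂ λ x y → x ≢ y × z ≢ x × z ≢ y × (∀ {s} → s ∈ S → s ≡ x ⊎ s ≡ y)

⊆⁅x⁆⇒coveringPair : 3 ≤ n → {S : Subset n} {x z : Fin n} → z ≢ x →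
                    (∀ {s} → s ∈ S → s ≡ x) → CoveringPair z S
⊆⁅x⁆⇒coveringPair 3≤n {x = x} {z} z≢x S⊆x =
  let y , y≢z , y≢x = avoid₂ 3≤n z x in x , y , ≢-sym y≢x , z≢x , ≢-sym y≢z , inj₁ ∘ S⊆x

coveringPair : 3 ≤ n → {S : Subset n} {z : Fin n} → z ∉ S → ∣ S ∣ ≤ 2 → CoveringPair z S
coveringPair 3≤n {S} {z} z∉S ∣S∣≤2 with any? (_∈? S)
... | no S-empty =
  let x , x≢z , _ = avoid₂ 3≤n z z in
  ⊆⁅x⁆⇒coveringPair 3≤n (≢-sym x≢z) (λ s∈S → ⊥-elim (S-empty (_ , s∈S)))
... | yes (x , x∈S) with any? (λ y → y ∈? S ×-dec ¬? (y ≟ x))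
...   | no only-x =
  ⊆⁅x⁆⇒coveringPair 3≤n (λ { refl → z∉S x∈S })
    (λ {s} s∈S → decidable-stable (s ≟ x) (λ s≢x → only-x (s , s∈S , s≢x)))
...   | yes (y , y∈S , y≢x) =
  x , y , ≢-sym y≢x , (λ { refl → z∉S x∈S }) , (λ { refl → z∉S y∈S }) , x-or-y
  where
  x-or-y : ∀ {s} → s ∈ S → s ≡ x ⊎ s ≡ y
  x-or-y {s} s∈S with s ≟ x | s ≟ y
  ... | yes s≡x | _       = inj₁ s≡x
  ... | no _    | yes s≡y = inj₂ s≡y
  ... | no s≢x  | no s≢y  =
    ⊥-elim (<⇒≱ (s≤s ∣S∣≤2) (three-members⇒3≤∣p∣ x∈S y∈S s∈S y≢x s≢x s≢y))

module _ {H : Graph n} {S : Fin n → Set} where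

  Reach-snoc : ∀ {u v w} → Reach H S u w → Adj H w v → ¬ S v → Reach H S u v
  Reach-snoc here          w~v v∉S = step w~v v∉S here
  Reach-snoc (step a w∉S r) w~v v∉S = step a w∉S (Reach-snoc r w~v v∉S)

  ¬Reach-stepˡ : ∀ {u v w} → Adj H u w → ¬ S w → ¬ Reach H S u v → ¬ Reach H S w v
  ¬Reach-stepˡ u~w w∉S u↛v = u↛v ∘ step u~w w∉S

  ¬Reach-stepʳ : ∀ {u v w} → Adj H w v → ¬ S v → ¬ Reach H S u v → ¬ Reach H S u w
  ¬Reach-stepʳ w~v v∉S u↛v r = u↛v (Reach-snoc r w~v v∉S)

NeighbourOutside : Graph n → (Fin n → Set) → Fin n → Set
NeighbourOutside H S z = ∃ λ w → ¬ S w × Adj H z w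

neighbourOutside? : (H : Graph n) {S : Fin n → Set} → Decidable S → Decidable (NeighbourOutside H S)
neighbourOutside? H S? z = any? (λ w → ¬? (S? w) ×-dec adj? H z w)

NoC4⇒common-neighbour-unique : (G : Graph n) → NoC4 G → ∀ {a b c d} → a ≢ c →
  Adj G a b → Adj G b c → Adj G a d → Adj G d c → b ≡ d
NoC4⇒common-neighbour-unique G noC4 {a} {b} {c} {d} a≢c a-b b-c a-d d-c =
  decidable-stable (b ≟ d) λ b≢d → noC4 a b c d a≢c b≢d a-b b-c (Graph.sym G d-c) (Graph.sym G a-d)

Separates⇒disconnected : {H : Graph n} {S : Subset n} → ∣ S ∣ + 1 < n → Separates H S →
  ∃₂ λ u v → u ∉ S × v ∉ S × ¬ Reach H (_∈ S) u v
Separates⇒disconnected ∣S∣+1<n = [ id , ⊥-elim ∘ <⇒≱ ∣S∣+1<n ]′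

module _ (G : Graph n) {S : Fin n → Set} where

  private
    Gᶜ : Graph n
    Gᶜ = complement G

  ¬Reachᶜ⇒Adj : ∀ {u v} → ¬ S v → ¬ Reach Gᶜ S u v → Adj G u v
  ¬Reachᶜ⇒Adj {u} {v} v∉S u↛v =
    decidable-stable (adj? G u v) λ u≁v → u↛v (step (u≢v , u≁v) v∉S here)
    where
    u≢v : u ≢ v
    u≢v refl = u↛v here

  ¬NeighbourOutsideᶜ⇒Adj : ∀ {z w} → ¬ NeighbourOutside Gᶜ S z → ¬ S w → z ≢ w → Adj G z w
  ¬NeighbourOutsideᶜ⇒Adj {z} {w} z-isolated w∉S z≢w =
    decidable-stable (adj? G z w) λ z≁w → z-isolated (w , w∉S , z≢w , z≁w)

  -- u, w₀ and v, w₁ lie in different components of Gᶜ − S, so u v w₀ w₁ is a 4-cycle of G.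
  NoC4⇒isolated-vertex : NoC4 G → Decidable S → ∀ {u v} → ¬ S u → ¬ S v → ¬ Reach Gᶜ S u v →
    ∃ λ z → ¬ S z × ¬ NeighbourOutside Gᶜ S z
  NoC4⇒isolated-vertex noC4 S? {u} {v} u∉S v∉S u↛v
    with neighbourOutside? Gᶜ S? u | neighbourOutside? Gᶜ S? v
  ... | no u-isolated | _             = u , u∉S , u-isolated
  ... | yes _         | no v-isolated = v , v∉S , v-isolated
  ... | yes (w₀ , w₀∉S , u~w₀) | yes (w₁ , w₁∉S , v~w₁) =
    ⊥-elim (noC4 u v w₀ w₁ (proj₁ u~w₀) (proj₁ v~w₁) u-v v-w₀ w₀-w₁ w₁-u)
    where
    w₀↛v : ¬ Reach Gᶜ S w₀ v
    w₀↛v = ¬Reach-stepˡ u~w₀ w₀∉S u↛v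
    u↛w₁ : ¬ Reach Gᶜ S u w₁
    u↛w₁ = ¬Reach-stepʳ (Graph.sym Gᶜ v~w₁) v∉S u↛v
    u-v : Adj G u v
    u-v = ¬Reachᶜ⇒Adj v∉S u↛v
    v-w₀ : Adj G v w₀
    v-w₀ = Graph.sym G (¬Reachᶜ⇒Adj v∉S w₀↛v)
    w₀-w₁ : Adj G w₀ w₁
    w₀-w₁ = ¬Reachᶜ⇒Adj w₁∉S (¬Reach-stepˡ u~w₀ w₀∉S u↛w₁)
    w₁-u : Adj G w₁ u
    w₁-u = Graph.sym G (¬Reachᶜ⇒Adj w₁∉S u↛w₁)

lemma8 : ∀ (n : ℕ) (G : Graph n) → 6 ≤ n → Planar G → NoC4 G →
    ∀ (k : ℕ) → IsConnectivity (complement G) k → k ≤ 2 →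
    ∃ λ (x : Fin n) → ∃ λ (y : Fin n) → ∃ λ (z : Fin n) →
      x ≢ y × z ≢ x × z ≢ y
      × (∀ (w : Fin n) → w ≢ x → w ≢ y → ¬ Adj (complement G) z w)
      × (∀ (a b c : Fin n) → a ≢ x → a ≢ y → a ≢ z → b ≢ x → b ≢ y → b ≢ z
           → c ≢ x → c ≢ y → c ≢ z → a ≢ c → Adj G a b → Adj G b c → ⊥)
lemma8 n G 6≤n _ noC4 k ((S , refl , S-separates) , _) k≤2
  with u , v , u∉S , v∉S , u↛v ← Separates⇒disconnected
                                       (≤-trans (s≤s (+-monoˡ-≤ 1 k≤2)) (≤-trans (m≤m+n 4 2) 6≤n))
                                       S-separates
  with z , z∉S , z-isolated ← NoC4⇒isolated-vertex G noC4 (_∈? S) u∉S v∉S u↛v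
  with x , y , x≢y , z≢x , z≢y , S⊆xy ← coveringPair (≤-trans (m≤m+n 3 3) 6≤n) z∉S k≤2
  = x , y , z , x≢y , z≢x , z≢y
  , (λ w w≢x w≢y z~w → z-isolated (w , outside w≢x w≢y , z~w))
  , λ a b c a≢x a≢y a≢z b≢x b≢y b≢z c≢x c≢y c≢z a≢c a-b b-c →
      b≢z (NoC4⇒common-neighbour-unique G noC4 a≢c a-b b-c
             (Graph.sym G (z-adj a≢x a≢y a≢z)) (z-adj c≢x c≢y c≢z))
  where
  outside : ∀ {w} → w ≢ x → w ≢ y → w ∉ S
  outside w≢x w≢y = [ w≢x , w≢y ]′ ∘ S⊆xy
  z-adj : ∀ {w} → w ≢ x → w ≢ y → w ≢ z → Adj G z w
  z-adj w≢x w≢y w≢z = ¬NeighbourOutsideᶜ⇒Adj G z-isolated (outside w≢x w≢y) (≢-sym w≢z)
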